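{- Let $\Gamma$ be a distance-regular graph of diameter $d$ whose odd girth is $2d+1$. Then the metric dimension of its bipartite double $D(\Gamma)$ equals the metric dimension of $\Gamma$.
   Context: The odd girth is the length of a shortest odd cycle. The bipartite double $D(\Gamma)$ of $\Gamma=(V,E)$ has vertex set $V^+\cup V^-$ (two disjoint copies of $V$), with $u^+\in V^+$ adjacent to $w^-\in V^-$ iff $u$ and $w$ are adjacent in $\Gamma$ (no edges within $V^+$ or within $V^-$). The metric dimension of a connected graph is the minimum size of a vertex set $R$ such that any two distinct vertices $x,y$ have some $w\in R$ with $\d(x,w)\ne\d(y,w)$, with $\d$ the path distance. A connected graph of diameter $d$ is distance-regular if for all $i$ and all $u,v$ at distance $i$, the numbers of neighbours of $v$ at distances $i-1,i,i+1$ from $u$ depend only on $i$. -}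

module Defs where

open import Data.Nat using (ℕ; zero; suc; _+_; _*_; _∸_; _≤_; _<_)
open import Data.Nat.Base using (NonZero)
open import Data.Bool using (Bool; true; false; T)
open import Data.Fin using (Fin; zero; suc; inject₁; fromℕ; splitAt)
open import Data.Fin.Subset using (Subset; _∈_; ∣_∣)
open import Data.Sum using (_⊎_; inj₁; inj₂)
open import Data.Product using (Σ; ∃; ∃-syntax; _×_; _,_)
open import Data.Empty using (⊥)
open import Relation.Nullary using (¬_)
open import Relation.Binary.PropositionalEquality using (_≡_; _≢_)
open import Function.Bundles using (_⇔_)
open import Function.Definitions using (Injective)

record Graph (n : ℕ) : Set where
  field
    adj   : Fin n → Fin n → Bool
    sym   : ∀ x y → adj x y ≡ adj y x
    irrefl : ∀ x → adj x x ≡ false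

open Graph public

Adj : ∀ {n} → Graph n → Fin n → Fin n → Set
Adj G x y = T (adj G x y)

data Walk {n : ℕ} (G : Graph n) : Fin n → Fin n → ℕ → Set where
  here  : ∀ {x} → Walk G x x zero
  step  : ∀ {x y z k} → Adj G x y → Walk G y z k → Walk G x z (suc k)

Dist : ∀ {n} → Graph n → Fin n → Fin n → ℕ → Set
Dist G x y k = Walk G x y k × (∀ m → m < k → ¬ Walk G x y m)

Connected : ∀ {n} → Graph n → Set
Connected G = ∀ x y → ∃[ k ] Walk G x y k

HasDiameter : ∀ {n} → Graph n → ℕ → Set
HasDiameter G d =
  Connected G × (∀ x y k → Dist G x y k → k ≤ d) × (∃[ x ] ∃[ y ] Dist G x y d)

NbrCount : ∀ {n} → Graph n → Fin n → Fin n → ℕ → ℕ → Set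
NbrCount {n} G u v j c =
  Σ (Subset n) λ S → (∀ w → (w ∈ S) ⇔ (Adj G v w × Dist G u w j)) × ∣ S ∣ ≡ c

DistanceRegular : ∀ {n} → Graph n → Set
DistanceRegular {n} G =
  Connected G ×
  (∀ i j (u v u' v' : Fin n) c c' →
     (j ≡ i ∸ 1 ⊎ j ≡ i ⊎ j ≡ suc i) →
     Dist G u v i → Dist G u' v' i →
     NbrCount G u v j c → NbrCount G u' v' j c' → c ≡ c')

Cycle : ∀ {n} → Graph n → ℕ → Set
Cycle {n} G zero = ⊥
Cycle {n} G (suc m) =
  2 ≤ m ×
  Σ (Fin (suc m) → Fin n) λ c →
    Injective _≡_ _≡_ c ×
    (∀ (i : Fin m) → Adj G (c (inject₁ i)) (c (suc i))) ×
    Adj G (c (fromℕ m)) (c zero)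

Odd : ℕ → Set
Odd k = ∃[ t ] k ≡ suc (2 * t)

OddGirth : ∀ {n} → Graph n → ℕ → Set
OddGirth G g = Odd g × Cycle G g × (∀ k → Odd k → Cycle G k → g ≤ k)

-- Bipartite double D(G) on Fin (n + n): first copy V⁺, second copy V⁻.
doubleAdj : ∀ {n} → Graph n → Fin (n + n) → Fin (n + n) → Bool
doubleAdj {n} G x y with splitAt n x | splitAt n y
... | inj₁ u | inj₂ w = adj G u w
... | inj₂ u | inj₁ w = adj G u w
... | inj₁ _ | inj₁ _ = false
... | inj₂ _ | inj₂ _ = false

doubleSym : ∀ {n} (G : Graph n) x y → doubleAdj G x y ≡ doubleAdj G y x
doubleSym {n} G x y with splitAt n x | splitAt n y
... | inj₁ u | inj₂ w = sym G u w
... | inj₂ u | inj₁ w = sym G u w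
... | inj₁ _ | inj₁ _ = _≡_.refl
... | inj₂ _ | inj₂ _ = _≡_.refl

doubleIrrefl : ∀ {n} (G : Graph n) x → doubleAdj G x x ≡ false
doubleIrrefl {n} G x with splitAt n x
... | inj₁ _ = _≡_.refl
... | inj₂ _ = _≡_.refl

BipartiteDouble : ∀ {n} → Graph n → Graph (n + n)
BipartiteDouble G = record
  { adj = doubleAdj G ; sym = doubleSym G ; irrefl = doubleIrrefl G }

Resolving : ∀ {n} → Graph n → Subset n → Set
Resolving G R = ∀ x y → x ≢ y →
  ∃[ w ] (w ∈ R × ∃[ k ] ∃[ l ] (Dist G x w k × Dist G y w l × k ≢ l))

MetricDimension : ∀ {n} → Graph n → ℕ → Set
MetricDimension {n} G m =
  (Σ (Subset n) λ R → Resolving G R × ∣ R ∣ ≡ m) ×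
  (∀ R → Resolving G R → m ≤ ∣ R ∣)

-- In a graph of diameter d whose odd cycles all have length at least 2d + 1, two walks between
-- the same pair of vertices whose lengths have different parities have total length at least
-- 2d + 1, since together they form an odd closed walk, which contains an odd cycle.
-- Distance-regularity supplies the matching walk: for u, w at distance i, go out from w to
-- distance d from u, cross an edge of that sphere (the odd cycle of length 2d + 1 shows
-- a_d > 0), and return, a walk of length 2d + 1 - i.  Hence the distance in D(Γ) from u^s to
-- w^t is i if i has the parity of s + t, and 2d + 1 - i > d otherwise.  On a fixed side of
-- D(Γ) this is an injective function of i, and vertices on different sides are separated by
-- the parity of their distance to any vertex.  So a resolving set R of Γ gives the resolving
-- set R⁺ of D(Γ), while the union of the two projections of a resolving set of D(Γ) resolves Γ.

module Submission where

open import Defs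
open import Data.Nat using (ℕ; zero; suc; _+_; _*_; _∸_; _≤_; _<_; z≤n; s≤s; z<s; parity)
open import Data.Nat.Properties
open import Data.Nat.Induction using (<-rec)
open import Data.Parity.Base using (Parity; 0ℙ; 1ℙ; _⁻¹) renaming (_+_ to _⊕_)
open import Data.Parity.Properties as ℙ using (+-homo-+; suc-homo-⁻¹; ⁻¹-selfInverse; ⁻¹-involutive)
open import Data.Bool using (T; true; false)
open import Data.Bool.Properties using (T-≡)
open import Data.Fin as F using (Fin; zero; suc; toℕ; inject₁; fromℕ; _↑ˡ_; _↑ʳ_)
import Data.Fin.Properties as FP
open import Data.Fin.Subset using (Subset; _∈_; ∣_∣; _∪_; _-_; Nonempty) renaming (⊥ to ∅)
open import Data.Fin.Subset.Properties using (x∈p∪q⁺; nonempty?; Empty-unique; ∣⊥∣≡0; ∣p∣≤∣x∷p∣; x∈p⇒∣p-x∣<∣p∣)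
open import Data.Vec using (_∷_; []; _++_; splitAt; tabulate; here; there)
open import Data.Vec.Properties using (lookup∘tabulate; []=⇒lookup; lookup⇒[]=)
open import Data.Sum using (_⊎_; inj₁; inj₂)
open import Data.Product using (∃₂; ∃-syntax; _×_; _,_; proj₁; proj₂)
open import Data.Empty using (⊥-elim)
open import Relation.Nullary using (¬_; Dec; yes; no)
open import Relation.Binary using (tri<; tri≈; tri>)
open import Relation.Nullary.Decidable as Dec using (_×-dec_; ¬?; T?; isYes; toWitness; fromWitness)
open import Relation.Unary using (Pred; Decidable)
open import Relation.Binary.Definitions using (DecidableEquality)
open import Relation.Binary.PropositionalEquality as ≡ using (_≡_; _≢_; refl; trans; cong; subst)
open import Function using (_∘_)
open import Function.Bundles using (_⇔_; mk⇔; Equivalence)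

least-witness : ∀ {p} {P : Pred ℕ p} → Decidable P → ∀ {k} → P k →
                ∃[ j ] (P j × (∀ m → m < j → ¬ P m))
least-witness {p} {P} P? {k} = <-rec (λ k → P k → LeastWitness) search k
  where
  LeastWitness : Set p
  LeastWitness = ∃[ j ] (P j × (∀ m → m < j → ¬ P m))

  search : ∀ k → (∀ {m} → m < k → P m → LeastWitness) → P k → LeastWitness
  search k smaller Pk with anyUpTo? P? k
  ... | yes (m , m<k , Pm) = smaller m<k Pm
  ... | no none = k , Pk , λ m m<k Pm → none (m , m<k , Pm)

injective-or-collision : ∀ {a} {A : Set a} → DecidableEquality A → (f : ℕ → A) (L : ℕ) →
  (∀ {i j} → i < L → j < L → f i ≡ f j → i ≡ j) ⊎ (∃₂ λ i j → i < j × j < L × f i ≡ f j)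
injective-or-collision _≟_ f zero = inj₁ λ ()
injective-or-collision _≟_ f (suc L) with anyUpTo? (λ i → f i ≟ f L) L | injective-or-collision _≟_ f L
... | yes (i , i<L , fi≡fL) | _ = inj₂ (i , L , i<L , ≤-refl , fi≡fL)
... | no _ | inj₂ (i , j , i<j , j<L , fi≡fj) = inj₂ (i , j , i<j , m<n⇒m<1+n j<L , fi≡fj)
... | no fresh | inj₁ injective = inj₁ injective′
  where
  injective′ : ∀ {i j} → i < suc L → j < suc L → f i ≡ f j → i ≡ j
  injective′ i<1+L j<1+L fi≡fj with m<1+n⇒m<n∨m≡n i<1+L | m<1+n⇒m<n∨m≡n j<1+L
  ... | inj₁ i<L  | inj₁ j<L  = injective i<L j<L fi≡fj
  ... | inj₁ i<L  | inj₂ refl = ⊥-elim (fresh (_ , i<L , fi≡fj))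
  ... | inj₂ refl | inj₁ j<L  = ⊥-elim (fresh (_ , j<L , ≡.sym fi≡fj))
  ... | inj₂ refl | inj₂ refl = refl

parity-suc : ∀ k → parity (suc k) ≡ parity k ⁻¹
parity-suc k = ≡.sym (⁻¹-selfInverse (suc-homo-⁻¹ k))

parity≡1ℙ⇒Odd : ∀ k → parity k ≡ 1ℙ → Odd k
parity≡1ℙ⇒Odd 1 _ = 0 , refl
parity≡1ℙ⇒Odd (suc (suc k)) odd with parity≡1ℙ⇒Odd k odd
... | t , refl = suc t , cong (2 +_) (≡.sym (+-suc t (t + 0)))

Odd⇒parity≡1ℙ : ∀ {k} → Odd k → parity k ≡ 1ℙ
Odd⇒parity≡1ℙ (t , refl) = trans (parity-suc (2 * t)) (cong _⁻¹ (ℙ.*-homo-* 2 t))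

odd-summand : ∀ m n → parity (m + n) ≡ 1ℙ → parity m ≡ 1ℙ ⊎ parity n ≡ 1ℙ
odd-summand m n odd with parity m in eq
... | 1ℙ = inj₁ refl
... | 0ℙ = inj₂ (trans (≡.sym (trans (+-homo-+ m n) (cong (_⊕ parity n) eq))) odd)

⁻¹-distribˡ-⊕ : ∀ p q → (p ⊕ q) ⁻¹ ≡ p ⁻¹ ⊕ q
⁻¹-distribˡ-⊕ 0ℙ q = refl
⁻¹-distribˡ-⊕ 1ℙ q = ⁻¹-involutive q

≢⇒≡⁻¹ : ∀ {p q} → p ≢ q → q ≡ p ⁻¹
≢⇒≡⁻¹ {0ℙ} {0ℙ} p≢q = ⊥-elim (p≢q refl)
≢⇒≡⁻¹ {0ℙ} {1ℙ} _   = refl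
≢⇒≡⁻¹ {1ℙ} {0ℙ} _   = refl
≢⇒≡⁻¹ {1ℙ} {1ℙ} p≢q = ⊥-elim (p≢q refl)

≢⇒⊕≡1ℙ : ∀ {p q} → p ≢ q → p ⊕ q ≡ 1ℙ
≢⇒⊕≡1ℙ {p} p≢q = trans (cong (p ⊕_) (≢⇒≡⁻¹ p≢q)) (ℙ.p+p⁻¹≡1ℙ p)

subset-of : ∀ {n p} {P : Pred (Fin n) p} → Decidable P → ∃[ S ] (∀ x → x ∈ S ⇔ P x)
subset-of P? = tabulate (isYes ∘ P?) , λ x → mk⇔
  (λ x∈S → toWitness {a? = P? x} (Equivalence.from T-≡
              (trans (≡.sym (lookup∘tabulate _ x)) ([]=⇒lookup x∈S))))
  (λ Px → lookup⇒[]= x _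
              (trans (lookup∘tabulate _ x) (Equivalence.to T-≡ (fromWitness {a? = P? x} Px))))

Nonempty⇒∣p∣≢0 : ∀ {n} {p : Subset n} → Nonempty p → ∣ p ∣ ≢ 0
Nonempty⇒∣p∣≢0 {p = p} (x , x∈p) ∣p∣≡0 = n≮0 (subst (∣ p - x ∣ <_) ∣p∣≡0 (x∈p⇒∣p-x∣<∣p∣ x∈p))

∣p∣≢0⇒Nonempty : ∀ {n} {p : Subset n} → ∣ p ∣ ≢ 0 → Nonempty p
∣p∣≢0⇒Nonempty {n} {p} ∣p∣≢0 with nonempty? p
... | yes p≢∅ = p≢∅
... | no p≡∅ = ⊥-elim (∣p∣≢0 (trans (cong ∣_∣ (Empty-unique p≡∅)) (∣⊥∣≡0 n)))

∣p++q∣≡∣p∣+∣q∣ : ∀ {m n} (p : Subset m) (q : Subset n) → ∣ p ++ q ∣ ≡ ∣ p ∣ + ∣ q ∣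
∣p++q∣≡∣p∣+∣q∣ []          q = refl
∣p++q∣≡∣p∣+∣q∣ (true  ∷ p) q = cong suc (∣p++q∣≡∣p∣+∣q∣ p q)
∣p++q∣≡∣p∣+∣q∣ (false ∷ p) q = ∣p++q∣≡∣p∣+∣q∣ p q

∣p∪q∣≤∣p∣+∣q∣ : ∀ {n} (p q : Subset n) → ∣ p ∪ q ∣ ≤ ∣ p ∣ + ∣ q ∣
∣p∪q∣≤∣p∣+∣q∣ []          []          = z≤n
∣p∪q∣≤∣p∣+∣q∣ (true  ∷ p) (b     ∷ q) = s≤s (≤-trans (∣p∪q∣≤∣p∣+∣q∣ p q) (+-monoʳ-≤ ∣ p ∣ (∣p∣≤∣x∷p∣ b q)))
∣p∪q∣≤∣p∣+∣q∣ (false ∷ p) (true  ∷ q) = ≤-trans (s≤s (∣p∪q∣≤∣p∣+∣q∣ p q)) (≤-reflexive (≡.sym (+-suc ∣ p ∣ ∣ q ∣)))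
∣p∪q∣≤∣p∣+∣q∣ (false ∷ p) (false ∷ q) = ∣p∪q∣≤∣p∣+∣q∣ p q

x∈p⇒x↑ˡ∈p++q : ∀ {m n} {p : Subset m} {q : Subset n} {x} → x ∈ p → x ↑ˡ n ∈ p ++ q
x∈p⇒x↑ˡ∈p++q here        = here
x∈p⇒x↑ˡ∈p++q (there x∈p) = there (x∈p⇒x↑ˡ∈p++q x∈p)

x↑ˡ∈p++q⇒x∈p : ∀ {m n} (p : Subset m) {q : Subset n} {x} → x ↑ˡ n ∈ p ++ q → x ∈ p
x↑ˡ∈p++q⇒x∈p (_ ∷ p) {x = zero}  here        = here
x↑ˡ∈p++q⇒x∈p (_ ∷ p) {x = suc x} (there x∈p) = there (x↑ˡ∈p++q⇒x∈p p x∈p)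

m↑ʳx∈p++q⇒x∈q : ∀ {m n} (p : Subset m) {q : Subset n} {x} → m ↑ʳ x ∈ p ++ q → x ∈ q
m↑ʳx∈p++q⇒x∈q []      x∈q         = x∈q
m↑ʳx∈p++q⇒x∈q (_ ∷ p) (there x∈q) = m↑ʳx∈p++q⇒x∈q p x∈q

module Walks {n} (G : Graph n) where

  adj-sym : ∀ {x y} → Adj G x y → Adj G y x
  adj-sym {x} {y} = subst T (sym G x y)

  infixr 5 _++ʷ_
  _++ʷ_ : ∀ {x y z a b} → Walk G x y a → Walk G y z b → Walk G x z (a + b)
  here     ++ʷ q = q
  step e p ++ʷ q = step e (p ++ʷ q)

  _∷ʳʷ_ : ∀ {x y z a} → Walk G x y a → Adj G y z → Walk G x z (suc a)
  here      ∷ʳʷ e = step e here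
  step e′ p ∷ʳʷ e = step e′ (p ∷ʳʷ e)

  reverseʷ : ∀ {x y a} → Walk G x y a → Walk G y x a
  reverseʷ here       = here
  reverseʷ (step e p) = reverseʷ p ∷ʳʷ adj-sym e

  splitʷ : ∀ {x y} a {b} → Walk G x y (a + b) → ∃[ z ] (Walk G x z a × Walk G z y b)
  splitʷ zero    p          = _ , here , p
  splitʷ (suc a) (step e p) with splitʷ a p
  ... | z , p₁ , p₂ = z , step e p₁ , p₂

  walk-0⇒≡ : ∀ {x y} → Walk G x y 0 → x ≡ y
  walk-0⇒≡ here = refl

  walk? : ∀ x y k → Dec (Walk G x y k)
  walk? x y zero with x F.≟ y
  ... | yes refl = yes here
  ... | no x≢y   = no λ { here → x≢y refl }
  walk? x y (suc k) with FP.any? (λ z → T? (adj G x z) ×-dec walk? z y k)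
  ... | yes (z , e , p) = yes (step e p)
  ... | no ∄step        = no λ { (step e p) → ∄step (_ , e , p) }

  dist? : ∀ x y k → Dec (Dist G x y k)
  dist? x y k = Dec.map′ (λ (p , short) → p , λ m m<k → short m<k)
                         (λ (p , short) → p , λ {m} → short m)
                         (walk? x y k ×-dec allUpTo? (λ m → ¬? (walk? x y m)) k)

  dist-unique : ∀ {x y a b} → Dist G x y a → Dist G x y b → a ≡ b
  dist-unique {a = a} {b} (p , a-short) (q , b-short) with <-cmp a b
  ... | tri< a<b _ _ = ⊥-elim (b-short a a<b p)
  ... | tri≈ _ a≡b _ = a≡b
  ... | tri> _ _ b<a = ⊥-elim (a-short b b<a q)

  walk⇒dist : ∀ {x y k} → Walk G x y k → ∃[ j ] Dist G x y j
  walk⇒dist {x} {y} p = least-witness (walk? x y) p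

  dist-prefix : ∀ {x y z a b} → Walk G x y a → Walk G y z b → Dist G x z (a + b) → Dist G x y a
  dist-prefix {b = b} p q (_ , short) = p , λ m m<a r → short (m + b) (+-monoˡ-< b m<a) (r ++ʷ q)

  neighbours-at : ∀ u v j → ∃[ c ] NbrCount G u v j c
  neighbours-at u v j with subset-of (λ w → T? (adj G v w) ×-dec dist? u w j)
  ... | S , S-spec = ∣ S ∣ , S , S-spec , refl

  neighbour⇒count≢0 : ∀ {u v w j c} → NbrCount G u v j c → Adj G v w → Dist G u w j → c ≢ 0
  neighbour⇒count≢0 {w = w} (S , S-spec , refl) e uw =
    Nonempty⇒∣p∣≢0 (w , Equivalence.from (S-spec w) (e , uw))

  count≢0⇒neighbour : ∀ {u v j c} → NbrCount G u v j c → c ≢ 0 → ∃[ w ] (Adj G v w × Dist G u w j)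
  count≢0⇒neighbour (S , S-spec , refl) c≢0 with ∣p∣≢0⇒Nonempty c≢0
  ... | w , w∈S = w , Equivalence.to (S-spec w) w∈S

  -- Beyond the length of the walk, vertex returns its endpoint.
  vertex : ∀ {x y k} → Walk G x y k → ℕ → Fin n
  vertex {x} _          zero    = x
  vertex {x} here       (suc i) = x
  vertex     (step _ p) (suc i) = vertex p i

  vertex-last : ∀ {x y k} (p : Walk G x y k) → vertex p k ≡ y
  vertex-last here       = refl
  vertex-last (step _ p) = vertex-last p

  vertex-adj : ∀ {x y k} (p : Walk G x y k) {i} → i < k → Adj G (vertex p i) (vertex p (suc i))
  vertex-adj (step e p) {zero}  _         = e
  vertex-adj (step e p) {suc i} (s≤s i<k) = vertex-adj p i<k

  segment : ∀ {x y k} (p : Walk G x y k) {i j} → i ≤ j → j ≤ k →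
            Walk G (vertex p i) (vertex p j) (j ∸ i)
  segment p          {zero}  {zero}  _         _         = here
  segment (step e p) {zero}  {suc j} _         (s≤s j≤k) = step e (segment p z≤n j≤k)
  segment (step e p) {suc i} {suc j} (s≤s i≤j) (s≤s j≤k) = segment p i≤j j≤k

  ClosedWalk : ℕ → Set
  ClosedWalk k = ∃[ x ] Walk G x x k

  cycle⇒closed-walk : ∀ {k} → Cycle G k → ClosedWalk k
  cycle⇒closed-walk {suc m} (_ , c , _ , c-adj , c-last) = c zero , along m c c-adj ∷ʳʷ c-last
    where
    along : ∀ m (c : Fin (suc m) → Fin n) → (∀ i → Adj G (c (inject₁ i)) (c (suc i))) →
            Walk G (c zero) (c (fromℕ m)) m
    along zero    c c-adj = here
    along (suc m) c c-adj = step (c-adj zero) (along m (c ∘ suc) (c-adj ∘ suc))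

  closed-walk-split : ∀ {x L} (p : Walk G x x L) {a b} → a < b → b < L → vertex p a ≡ vertex p b →
                      ∃₂ λ l₁ l₂ → l₁ + l₂ ≡ L × l₁ < L × l₂ < L × ClosedWalk l₁ × ClosedWalk l₂
  closed-walk-split {x} {L} p {a} {b} a<b b<L pa≡pb =
    b ∸ a , a + (L ∸ b) , lengths , inner<L , outer<L , (vertex p a , inner) , (x , outer)
    where
    lengths : (b ∸ a) + (a + (L ∸ b)) ≡ L
    lengths = trans (≡.sym (+-assoc (b ∸ a) a (L ∸ b)))
                    (trans (cong (_+ (L ∸ b)) (m∸n+n≡m (<⇒≤ a<b))) (m+[n∸m]≡n (<⇒≤ b<L)))
    inner<L : b ∸ a < L
    inner<L = ≤-<-trans (m∸n≤m b a) b<L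
    outer<L : a + (L ∸ b) < L
    outer<L = subst (a + (L ∸ b) <_) (m+[n∸m]≡n (<⇒≤ b<L)) (+-monoˡ-< (L ∸ b) a<b)
    inner : Walk G (vertex p a) (vertex p a) (b ∸ a)
    inner = subst (λ y → Walk G (vertex p a) y (b ∸ a)) (≡.sym pa≡pb) (segment p (<⇒≤ a<b) (<⇒≤ b<L))
    outer : Walk G x x (a + (L ∸ b))
    outer = segment p z≤n (<⇒≤ (<-trans a<b b<L))
         ++ʷ ≡.subst₂ (λ y z → Walk G y z (L ∸ b)) (≡.sym pa≡pb) (vertex-last p) (segment p (<⇒≤ b<L) ≤-refl)

  odd-closed-walk⇒cycle : ∀ {x L} (p : Walk G x x L) → parity L ≡ 1ℙ →
                          (∀ {i j} → i < L → j < L → vertex p i ≡ vertex p j → i ≡ j) → Cycle G L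
  odd-closed-walk⇒cycle {L = 0} _ () _
  odd-closed-walk⇒cycle {L = 2} _ () _
  odd-closed-walk⇒cycle (step e here) _ _ = ⊥-elim (subst T (irrefl G _) e)
  odd-closed-walk⇒cycle {L = suc m@(suc (suc _))} p _ injective =
    s≤s (s≤s z≤n) , c , c-injective , c-adj , c-last
    where
    c : Fin (suc m) → Fin n
    c i = vertex p (toℕ i)
    c-injective : ∀ {i j} → c i ≡ c j → i ≡ j
    c-injective {i} {j} ci≡cj = FP.toℕ-injective (injective (FP.toℕ<n i) (FP.toℕ<n j) ci≡cj)
    c-adj : ∀ i → Adj G (c (inject₁ i)) (c (suc i))
    c-adj i = subst (λ k → Adj G (vertex p k) (c (suc i))) (≡.sym (FP.toℕ-inject₁ i))
                    (vertex-adj p (m<n⇒m<1+n (FP.toℕ<n i)))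
    c-last : Adj G (c (fromℕ m)) (c zero)
    c-last = ≡.subst₂ (λ k y → Adj G (vertex p k) y) (≡.sym (FP.toℕ-fromℕ m)) (vertex-last p)
                      (vertex-adj p (n<1+n m))

  odd-closed-walk⇒odd-cycle : ∀ {L} → ClosedWalk L → parity L ≡ 1ℙ → ∃[ k ] (k ≤ L × Odd k × Cycle G k)
  odd-closed-walk⇒odd-cycle {L} = <-rec OddCycleWithin shorten L
    where
    OddCycleWithin : ℕ → Set
    OddCycleWithin L = ClosedWalk L → parity L ≡ 1ℙ → ∃[ k ] (k ≤ L × Odd k × Cycle G k)

    relax : ∀ {l L} → l ≤ L → ∃[ k ] (k ≤ l × Odd k × Cycle G k) → ∃[ k ] (k ≤ L × Odd k × Cycle G k)
    relax l≤L (k , k≤l , k-odd , cycle) = k , ≤-trans k≤l l≤L , k-odd , cycle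

    -- A repeated vertex splits the walk into two shorter closed walks, one of odd length.
    shorten : ∀ L → (∀ {l} → l < L → OddCycleWithin l) → OddCycleWithin L
    shorten L shorter (x , p) odd with injective-or-collision F._≟_ (vertex p) L
    ... | inj₁ injective = L , ≤-refl , parity≡1ℙ⇒Odd L odd , odd-closed-walk⇒cycle p odd injective
    ... | inj₂ (a , b , a<b , b<L , pa≡pb) with closed-walk-split p a<b b<L pa≡pb
    ...   | l₁ , l₂ , refl , l₁<L , l₂<L , w₁ , w₂ with odd-summand l₁ l₂ odd
    ...     | inj₁ l₁-odd = relax (<⇒≤ l₁<L) (shorter l₁<L w₁ l₁-odd)
    ...     | inj₂ l₂-odd = relax (<⇒≤ l₂<L) (shorter l₂<L w₂ l₂-odd)

  module OddCyclesAtLeast {g} (odd-cycles-≥ : ∀ k → Odd k → Cycle G k → g ≤ k) where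

    odd-closed-walk-length : ∀ {L} → ClosedWalk L → parity L ≡ 1ℙ → g ≤ L
    odd-closed-walk-length w odd with odd-closed-walk⇒odd-cycle w odd
    ... | k , k≤L , k-odd , cycle = ≤-trans (odd-cycles-≥ k k-odd cycle) k≤L

    parity-mismatch-length : ∀ {x y a b} → Walk G x y a → Walk G x y b → parity a ≢ parity b → g ≤ a + b
    parity-mismatch-length {a = a} {b} p q a≢b =
      odd-closed-walk-length (_ , p ++ʷ reverseʷ q) (trans (+-homo-+ a b) (≢⇒⊕≡1ℙ a≢b))

module DistanceRegularGraph {n} {G : Graph n} (drg : DistanceRegular G) where
  open Walks G

  neighbour-transfer : ∀ {i j u v u′ v′ w′} → (j ≡ i ∸ 1 ⊎ j ≡ i ⊎ j ≡ suc i) →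
                       Dist G u v i → Dist G u′ v′ i → Adj G v′ w′ → Dist G u′ w′ j →
                       ∃[ w ] (Adj G v w × Dist G u w j)
  neighbour-transfer {i} {j} {u} {v} {u′} {v′} j-near uv u′v′ e u′w′
    with neighbours-at u v j | neighbours-at u′ v′ j
  ... | c , count | c′ , count′ =
    count≢0⇒neighbour count λ c≡0 → neighbour⇒count≢0 count′ e u′w′ (trans (≡.sym c≡c′) c≡0)
    where
    c≡c′ : c ≡ c′
    c≡c′ = proj₂ drg i j u v u′ v′ c c′ j-near uv u′v′ count count′

  module _ {d} (diameter : HasDiameter G d) where

    dist≤diameter : ∀ {x y k} → Dist G x y k → k ≤ d
    dist≤diameter {x} {y} {k} = proj₁ (proj₂ diameter) x y k

    outward-neighbour : ∀ {i u v} → i < d → Dist G u v i → ∃[ w ] (Adj G v w × Dist G u w (suc i))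
    outward-neighbour {i} {u} {v} i<d uv with proj₂ (proj₂ diameter)
    ... | x , y , xy = step-out (splitʷ i (subst (Walk G x y) (≡.sym i+[1+r]≡d) (proj₁ xy)))
      where
      r : ℕ
      r = d ∸ suc i
      [1+i]+r≡d : suc i + r ≡ d
      [1+i]+r≡d = m+[n∸m]≡n i<d
      i+[1+r]≡d : i + suc r ≡ d
      i+[1+r]≡d = trans (+-suc i r) [1+i]+r≡d
      step-out : ∃[ z ] (Walk G x z i × Walk G z y (suc r)) → ∃[ w ] (Adj G v w × Dist G u w (suc i))
      step-out (z , p , step e q) = neighbour-transfer (inj₂ (inj₂ refl)) uv
        (dist-prefix p (step e q) (subst (Dist G x y) (≡.sym i+[1+r]≡d) xy)) e
        (dist-prefix (p ∷ʳʷ e) q (subst (Dist G x y) (≡.sym [1+i]+r≡d) xy))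

    outward-walk : ∀ {i u v} → Dist G u v i → ∃[ z ] (Dist G u z d × Walk G v z (d ∸ i))
    outward-walk {i} {u} uv = go (d ∸ i) (m+[n∸m]≡n (dist≤diameter uv)) uv
      where
      go : ∀ r {i v} → i + r ≡ d → Dist G u v i → ∃[ z ] (Dist G u z d × Walk G v z r)
      go zero    {i} {v} i+0≡d uv = v , subst (Dist G u v) (trans (≡.sym (+-identityʳ i)) i+0≡d) uv , here
      go (suc r) {i} i+1+r≡d uv with outward-neighbour (subst (i <_) i+1+r≡d (m<m+n i z<s)) uv
      ... | w , e , uw with go r (trans (≡.sym (+-suc i r)) i+1+r≡d) uw
      ... | z , uz , wz = z , uz , step e wz

module BipartiteDoubleWalks {n} (G : Graph n) where

  D : Graph (n + n)
  D = BipartiteDouble G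

  open Walks D using (walk-0⇒≡)

  -- mk 0ℙ u is u⁺ and mk 1ℙ u is u⁻.
  mk : Parity → Fin n → Fin (n + n)
  mk 0ℙ u = u ↑ˡ n
  mk 1ℙ u = n ↑ʳ u

  data View : Fin (n + n) → Set where
    mk-view : ∀ s u → View (mk s u)

  view : ∀ x → View x
  view x with F.splitAt n x in eq
  ... | inj₁ u = subst View (FP.splitAt⁻¹-↑ˡ eq) (mk-view 0ℙ u)
  ... | inj₂ u = subst View (FP.splitAt⁻¹-↑ʳ eq) (mk-view 1ℙ u)

  adj-mk : ∀ s t u w → Adj D (mk s u) (mk t w) → Adj G u w × t ≡ s ⁻¹
  adj-mk 0ℙ 0ℙ u w e rewrite FP.splitAt-↑ˡ n u n | FP.splitAt-↑ˡ n w n = ⊥-elim e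
  adj-mk 0ℙ 1ℙ u w e rewrite FP.splitAt-↑ˡ n u n | FP.splitAt-↑ʳ n n w = e , refl
  adj-mk 1ℙ 0ℙ u w e rewrite FP.splitAt-↑ʳ n n u | FP.splitAt-↑ˡ n w n = e , refl
  adj-mk 1ℙ 1ℙ u w e rewrite FP.splitAt-↑ʳ n n u | FP.splitAt-↑ʳ n n w = ⊥-elim e

  mk-adj : ∀ s {u w} → Adj G u w → Adj D (mk s u) (mk (s ⁻¹) w)
  mk-adj 0ℙ {u} {w} e rewrite FP.splitAt-↑ˡ n u n | FP.splitAt-↑ʳ n n w = e
  mk-adj 1ℙ {u} {w} e rewrite FP.splitAt-↑ʳ n n u | FP.splitAt-↑ˡ n w n = e

  mk-injective : ∀ s t {u w} → mk s u ≡ mk t w → s ≡ t × u ≡ w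
  mk-injective 0ℙ 0ℙ {u} {w} eq = refl , FP.↑ˡ-injective n u w eq
  mk-injective 1ℙ 1ℙ {u} {w} eq = refl , FP.↑ʳ-injective n u w eq
  mk-injective 0ℙ 1ℙ {u} {w} eq
    with trans (≡.sym (FP.splitAt-↑ˡ n u n)) (trans (cong (F.splitAt n) eq) (FP.splitAt-↑ʳ n n w))
  ... | ()
  mk-injective 1ℙ 0ℙ {u} {w} eq
    with trans (≡.sym (FP.splitAt-↑ʳ n n u)) (trans (cong (F.splitAt n) eq) (FP.splitAt-↑ˡ n w n))
  ... | ()

  lift : ∀ s t {u w k} → parity k ≡ s ⊕ t → Walk G u w k → Walk D (mk s u) (mk t w) k
  lift 0ℙ 0ℙ _ here = here
  lift 1ℙ 1ℙ _ here = here
  lift s t {k = suc k} k-parity (step e p) = step (mk-adj s e) (lift (s ⁻¹) t k′-parity p)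
    where
    k′-parity : parity k ≡ s ⁻¹ ⊕ t
    k′-parity = trans (≡.sym (⁻¹-selfInverse (trans (≡.sym (parity-suc k)) k-parity))) (⁻¹-distribˡ-⊕ s t)

  project : ∀ s t {u w k} → Walk D (mk s u) (mk t w) k → Walk G u w k × parity k ≡ s ⊕ t
  project s t {k = zero} p with mk-injective s t (walk-0⇒≡ p)
  ... | refl , refl = here , ≡.sym (ℙ.p+p≡0ℙ s)
  project s t (step {y = z} {k = k} e p) with view z
  ... | mk-view s′ v with adj-mk s s′ _ v e | project s′ t p
  ... | e′ , refl | p′ , k-parity = step e′ p′ , (begin
    parity (suc k)       ≡⟨ parity-suc k ⟩
    parity k ⁻¹          ≡⟨ cong _⁻¹ k-parity ⟩
    (s ⁻¹ ⊕ t) ⁻¹        ≡⟨ ⁻¹-distribˡ-⊕ (s ⁻¹) t ⟩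
    s ⁻¹ ⁻¹ ⊕ t          ≡⟨ cong (_⊕ t) (⁻¹-involutive s) ⟩
    s ⊕ t                ∎)
    where open ≡.≡-Reasoning

  mk∈p++q⇒∈p∪q : ∀ s {x} (p q : Subset n) → mk s x ∈ p ++ q → x ∈ p ∪ q
  mk∈p++q⇒∈p∪q 0ℙ p q x∈ = x∈p∪q⁺ (inj₁ (x↑ˡ∈p++q⇒x∈p p x∈))
  mk∈p++q⇒∈p∪q 1ℙ p q x∈ = x∈p∪q⁺ (inj₂ (m↑ʳx∈p++q⇒x∈q p x∈))

  same-length⇒same-side : ∀ s t r {u w c k l} → Walk D (mk s u) (mk r c) k → Walk D (mk t w) (mk r c) l →
                          k ≡ l → s ≡ t
  same-length⇒same-side s t r p q refl =
    ℙ.+-cancelʳ-≡ r s t (trans (≡.sym (proj₂ (project s r p))) (proj₂ (project t r q)))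

Separates : ∀ {n} → Graph n → Subset n → Fin n → Fin n → Set
Separates G R x y = ∃[ w ] (w ∈ R × ∃[ k ] ∃[ l ] (Dist G x w k × Dist G y w l × k ≢ l))

module MaximalOddGirth {n} {G : Graph n} {d} (drg : DistanceRegular G) (diameter : HasDiameter G d)
                       (odd-girth : OddGirth G (suc (2 * d))) where
  open Walks G
  open DistanceRegularGraph drg
  open BipartiteDoubleWalks G

  open Walks D using () renaming (dist-unique to dist-uniqueᴰ)

  dist-exists : ∀ x y → ∃[ i ] Dist G x y i
  dist-exists x y = walk⇒dist (proj₂ (proj₁ drg x y))

  open OddCyclesAtLeast (proj₂ (proj₂ odd-girth))

  2d+1≡d+[1+d] : suc (2 * d) ≡ d + suc d
  2d+1≡d+[1+d] = trans (cong (λ e → suc (d + e)) (+-identityʳ d)) (≡.sym (+-suc d d))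

  walks-of-length-d-and-suc-d⇒dist-d : ∀ {x y} → Walk G x y d → Walk G x y (suc d) → Dist G x y d
  walks-of-length-d-and-suc-d⇒dist-d p q = p , shortest
    where
    open ≤-Reasoning
    shortest : ∀ m → m < d → ¬ Walk G _ _ m
    shortest m m<d r with parity m ℙ.≟ parity d
    ... | no  m≢d = <⇒≱ m+d<2d+1 (parity-mismatch-length r p m≢d)
      where
      m+d<2d+1 : m + d < suc (2 * d)
      m+d<2d+1 = begin-strict
        m + d      <⟨ +-monoˡ-< d m<d ⟩
        d + d      <⟨ +-monoʳ-< d (n<1+n d) ⟩
        d + suc d  ≡⟨ ≡.sym 2d+1≡d+[1+d] ⟩
        suc (2 * d) ∎
    ... | yes m≡d = <⇒≱ m+[1+d]<2d+1 (parity-mismatch-length r q m≢1+d)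
      where
      m+[1+d]<2d+1 : m + suc d < suc (2 * d)
      m+[1+d]<2d+1 = subst (m + suc d <_) (≡.sym 2d+1≡d+[1+d]) (+-monoˡ-< (suc d) m<d)
      m≢1+d : parity m ≢ parity (suc d)
      m≢1+d m≡1+d = ℙ.p≢p⁻¹ (parity d) (trans (≡.sym m≡d) (trans m≡1+d (parity-suc d)))

  antipodal-neighbour : ∀ {u v} → Dist G u v d → ∃[ w ] (Adj G v w × Dist G u w d)
  antipodal-neighbour uv with cycle⇒closed-walk (proj₁ (proj₂ odd-girth))
  ... | x , cycle with splitʷ d (subst (Walk G x x) 2d+1≡d+[1+d] cycle)
  ... | z , p , step {y = z′} e q = neighbour-transfer (inj₂ (inj₁ refl)) uv xz e xz′
    where
    xz : Dist G x z d
    xz = walks-of-length-d-and-suc-d⇒dist-d p (reverseʷ (step e q))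
    xz′ : Dist G x z′ d
    xz′ = walks-of-length-d-and-suc-d⇒dist-d (reverseʷ q) (p ∷ʳʷ e)

  complementary : ℕ → ℕ
  complementary i = (d ∸ i) + suc d

  i+complementary≡2d+1 : ∀ {i} → i ≤ d → i + complementary i ≡ suc (2 * d)
  i+complementary≡2d+1 {i} i≤d = trans (≡.sym (+-assoc i (d ∸ i) (suc d)))
                                       (trans (cong (_+ suc d) (m+[n∸m]≡n i≤d)) (≡.sym 2d+1≡d+[1+d]))

  d<complementary : ∀ i → d < complementary i
  d<complementary i = m≤n+m (suc d) (d ∸ i)

  complementary-injective : ∀ {i j} → i ≤ d → j ≤ d → complementary i ≡ complementary j → i ≡ j
  complementary-injective i≤d j≤d eq = ∸-cancelˡ-≡ i≤d j≤d (+-cancelʳ-≡ (suc d) _ _ eq)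

  parity-complementary : ∀ {i} → i ≤ d → parity (complementary i) ≡ parity i ⁻¹
  parity-complementary {i} i≤d = ℙ.+-cancelˡ-≡ (parity i) _ _ (begin
    parity i ⊕ parity (complementary i)  ≡⟨ ≡.sym (+-homo-+ i (complementary i)) ⟩
    parity (i + complementary i)         ≡⟨ cong parity (i+complementary≡2d+1 i≤d) ⟩
    parity (suc (2 * d))                 ≡⟨ Odd⇒parity≡1ℙ (proj₁ odd-girth) ⟩
    1ℙ                                   ≡⟨ ≡.sym (ℙ.p+p⁻¹≡1ℙ (parity i)) ⟩
    parity i ⊕ parity i ⁻¹               ∎)
    where open ≡.≡-Reasoning

  complementary-walk : ∀ {u v i} → Dist G u v i → Walk G u v (complementary i)
  complementary-walk uv with outward-walk diameter uv
  ... | z , uz , vz with antipodal-neighbour uz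
  ... | z′ , e , uz′ = reverseʷ (vz ++ʷ step e (reverseʷ (proj₁ uz′)))

  complementary-minimal : ∀ {u v i m} → Dist G u v i → Walk G u v m → parity m ≢ parity i →
                          complementary i ≤ m
  complementary-minimal {i = i} {m} uv p m≢i =
    +-cancelˡ-≤ i _ _ (subst (_≤ i + m) (≡.sym (i+complementary≡2d+1 (dist≤diameter diameter uv)))
                                 (parity-mismatch-length (proj₁ uv) p (m≢i ∘ ≡.sym)))

  doubleDist : ℕ → Parity → ℕ
  doubleDist i p with parity i ℙ.≟ p
  ... | yes _ = i
  ... | no  _ = complementary i

  doubleDist-injective : ∀ {i j p} → i ≤ d → j ≤ d → doubleDist i p ≡ doubleDist j p → i ≡ j
  doubleDist-injective {i} {j} {p} i≤d j≤d eq with parity i ℙ.≟ p | parity j ℙ.≟ p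
  ... | yes _ | yes _ = eq
  ... | no  _ | no  _ = complementary-injective i≤d j≤d eq
  ... | yes _ | no  _ = ⊥-elim (<⇒≱ (d<complementary j) (subst (_≤ d) eq i≤d))
  ... | no  _ | yes _ = ⊥-elim (<⇒≱ (d<complementary i) (subst (_≤ d) (≡.sym eq) j≤d))

  dist-double : ∀ s t {u w i} → Dist G u w i → Dist D (mk s u) (mk t w) (doubleDist i (s ⊕ t))
  dist-double s t {u} {w} {i} uw with parity i ℙ.≟ s ⊕ t
  ... | yes i≡s⊕t = lift s t i≡s⊕t (proj₁ uw) , λ m m<i p → proj₂ uw m m<i (proj₁ (project s t p))
  ... | no  i≢s⊕t = lift s t compl≡s⊕t (complementary-walk uw) , shortest
    where
    compl≡s⊕t : parity (complementary i) ≡ s ⊕ t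
    compl≡s⊕t = trans (parity-complementary (dist≤diameter diameter uw)) (≡.sym (≢⇒≡⁻¹ i≢s⊕t))
    shortest : ∀ m → m < complementary i → ¬ Walk D (mk s u) (mk t w) m
    shortest m m<compl p with project s t p
    ... | p′ , m≡s⊕t = <⇒≱ m<compl (complementary-minimal uw p′ λ m≡i → i≢s⊕t (trans (≡.sym m≡i) m≡s⊕t))

  dist-double-≡⇔ : ∀ s r {u w c i j k l} → Dist G u c i → Dist G w c j →
                   Dist D (mk s u) (mk r c) k → Dist D (mk s w) (mk r c) l → i ≡ j ⇔ k ≡ l
  dist-double-≡⇔ s r {i = i} {j} {k} {l} uc wc ucᴰ wcᴰ = mk⇔
    (λ { refl → trans (dist-uniqueᴰ ucᴰ (dist-double s r uc)) (dist-uniqueᴰ (dist-double s r wc) wcᴰ) })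
    (λ k≡l → doubleDist-injective (dist≤diameter diameter uc) (dist≤diameter diameter wc) (begin
      doubleDist i (s ⊕ r)  ≡⟨ dist-uniqueᴰ (dist-double s r uc) ucᴰ ⟩
      k                     ≡⟨ k≡l ⟩
      l                     ≡⟨ dist-uniqueᴰ wcᴰ (dist-double s r wc) ⟩
      doubleDist j (s ⊕ r)  ∎))
    where open ≡.≡-Reasoning

  -- A cycle has at least three vertices.
  0<d : 0 < d
  0<d = *-cancelˡ-≤ 2 (proj₁ (proj₁ (proj₂ odd-girth)))

  resolving-nonempty : ∀ {R} → Resolving G R → Nonempty R
  resolving-nonempty R-resolves with proj₂ (proj₂ diameter)
  ... | x , y , xy with R-resolves x y (λ { refl → proj₂ xy 0 0<d here })
  ... | r , r∈R , _ = r , r∈R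

  vertex-separates-sides : ∀ {R r s t u w} → r ∈ R → s ≢ t → Separates D (R ++ ∅) (mk s u) (mk t w)
  vertex-separates-sides {r = r} {s} {t} {u} {w} r∈R s≢t with dist-exists u r | dist-exists w r
  ... | i , ur | j , wr = mk 0ℙ r , x∈p⇒x↑ˡ∈p++q r∈R , _ , _ , urᴰ , wrᴰ ,
                          s≢t ∘ same-length⇒same-side s t 0ℙ (proj₁ urᴰ) (proj₁ wrᴰ)
    where
    urᴰ : Dist D (mk s u) (mk 0ℙ r) (doubleDist i (s ⊕ 0ℙ))
    urᴰ = dist-double s 0ℙ ur
    wrᴰ : Dist D (mk t w) (mk 0ℙ r) (doubleDist j (t ⊕ 0ℙ))
    wrᴰ = dist-double t 0ℙ wr

  lift-separates : ∀ {R s u w} → Separates G R u w → Separates D (R ++ ∅) (mk s u) (mk s w)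
  lift-separates {s = s} {u} {w} (c , c∈R , i , j , uc , wc , i≢j) =
    mk 0ℙ c , x∈p⇒x↑ˡ∈p++q c∈R , _ , _ , ucᴰ , wcᴰ , i≢j ∘ Equivalence.from (dist-double-≡⇔ s 0ℙ uc wc ucᴰ wcᴰ)
    where
    ucᴰ : Dist D (mk s u) (mk 0ℙ c) (doubleDist i (s ⊕ 0ℙ))
    ucᴰ = dist-double s 0ℙ uc
    wcᴰ : Dist D (mk s w) (mk 0ℙ c) (doubleDist j (s ⊕ 0ℙ))
    wcᴰ = dist-double s 0ℙ wc

  project-separates : ∀ {S₁ S₂ u w} → Separates D (S₁ ++ S₂) (mk 0ℙ u) (mk 0ℙ w) → Separates G (S₁ ∪ S₂) u w
  project-separates {S₁} {S₂} {u} {w} (c , c∈S , _ , _ , ucᴰ , wcᴰ , k≢l) with view c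
  ... | mk-view r x with dist-exists u x | dist-exists w x
  ... | _ , ux | _ , wx = x , mk∈p++q⇒∈p∪q r S₁ S₂ c∈S , _ , _ , ux , wx ,
                          k≢l ∘ Equivalence.to (dist-double-≡⇔ 0ℙ r ux wx ucᴰ wcᴰ)

  lift-resolving : ∀ {R} → Resolving G R → Resolving D (R ++ ∅)
  lift-resolving R-resolves x y x≢y with view x | view y
  ... | mk-view s u | mk-view t w with s ℙ.≟ t | resolving-nonempty R-resolves
  ... | no  s≢t  | _ , r∈R = vertex-separates-sides r∈R s≢t
  ... | yes refl | _       = lift-separates {s = s} (R-resolves u w (x≢y ∘ cong (mk s)))

  project-resolving : ∀ {S₁ S₂} → Resolving D (S₁ ++ S₂) → Resolving G (S₁ ∪ S₂)
  project-resolving S-resolves u w u≢w = project-separates (S-resolves _ _ (u≢w ∘ FP.↑ˡ-injective n u w))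

theorem2p9 : ∀ {n} (Γ : Graph n) (d : ℕ) →
    DistanceRegular Γ → HasDiameter Γ d → OddGirth Γ (suc (2 * d)) →
    ∀ m → MetricDimension Γ m → MetricDimension (BipartiteDouble Γ) m
theorem2p9 {n} Γ d drg diameter odd-girth m ((R , R-resolves , ∣R∣≡m) , R-minimal) =
  (R ++ ∅ , lift-resolving R-resolves , ∣R++∅∣≡m) , D-minimal
  where
  open MaximalOddGirth drg diameter odd-girth
  open BipartiteDoubleWalks Γ using (D)

  ∣R++∅∣≡m : ∣ R ++ ∅ ∣ ≡ m
  ∣R++∅∣≡m = begin
    ∣ R ++ ∅ ∣        ≡⟨ ∣p++q∣≡∣p∣+∣q∣ R ∅ ⟩
    ∣ R ∣ + ∣ ∅ {n} ∣ ≡⟨ cong (∣ R ∣ +_) (∣⊥∣≡0 n) ⟩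
    ∣ R ∣ + 0         ≡⟨ +-identityʳ _ ⟩
    ∣ R ∣             ≡⟨ ∣R∣≡m ⟩
    m                 ∎
    where open ≡.≡-Reasoning

  D-minimal : ∀ S → Resolving D S → m ≤ ∣ S ∣
  D-minimal S S-resolves with splitAt n S
  ... | S₁ , S₂ , refl = begin
    m                  ≤⟨ R-minimal (S₁ ∪ S₂) (project-resolving S-resolves) ⟩
    ∣ S₁ ∪ S₂ ∣        ≤⟨ ∣p∪q∣≤∣p∣+∣q∣ S₁ S₂ ⟩
    ∣ S₁ ∣ + ∣ S₂ ∣    ≡⟨ ≡.sym (∣p++q∣≡∣p∣+∣q∣ S₁ S₂) ⟩
    ∣ S₁ ++ S₂ ∣       ∎
    where open ≤-Reasoning
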